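{- For integers $n\ge m>1$, $\det'(K_{n,m})=n-1$ if $n\ne m$, and $\det'(K_{n,m})=n$ if $n=m$.
   Context: $K_{n,m}$ is the complete bipartite graph with parts of sizes $n$ and $m$. For a graph with at most one isolated vertex and no $K_2$ component, an edge set $T$ is an edge determining set if the only automorphism $\phi$ with $\{\phi(u),\phi(v)\}=\{u,v\}$ for all $\{u,v\}\in T$ is the identity; $\det'(G)$ is the minimum size of such a set. -}

module Defs where

open import Data.Nat using (ℕ; _≤_)
open import Data.Fin using (Fin)
open import Data.Sum using (_⊎_; inj₁; inj₂)
open import Data.Product using (_×_; _,_; Σ)
open import Data.Unit using (⊤)
open import Data.Empty using (⊥)
open import Data.List using (List; length)
open import Data.List.Membership.Propositional using (_∈_)
open import Data.List.Relation.Unary.Unique.Propositional using (Unique)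
open import Function.Bundles using (_↔_; _⇔_; Inverse)
open import Relation.Binary.PropositionalEquality using (_≡_)

V : ℕ → ℕ → Set
V n m = Fin n ⊎ Fin m

Adj : ∀ {n m} → V n m → V n m → Set
Adj (inj₁ _) (inj₁ _) = ⊥
Adj (inj₁ _) (inj₂ _) = ⊤
Adj (inj₂ _) (inj₁ _) = ⊤
Adj (inj₂ _) (inj₂ _) = ⊥

-- An edge {u,v} of K_{n,m} is determined by (i , j) with u = inj₁ i, v = inj₂ j.
Edge : ℕ → ℕ → Set
Edge n m = Fin n × Fin m

record Aut (n m : ℕ) : Set where
  field
    perm     : V n m ↔ V n m
    preserve : ∀ u v → Adj u v ⇔ Adj (Inverse.to perm u) (Inverse.to perm v)

open Aut public

FixesEdge : ∀ {n m} → Aut n m → Edge n m → Set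
FixesEdge φ (i , j) =
  (f (inj₁ i) ≡ inj₁ i × f (inj₂ j) ≡ inj₂ j) ⊎
  (f (inj₁ i) ≡ inj₂ j × f (inj₂ j) ≡ inj₁ i)
  where f = Inverse.to (perm φ)

IsIdentity : ∀ {n m} → Aut n m → Set
IsIdentity φ = ∀ v → Inverse.to (perm φ) v ≡ v

-- Edge sets are duplicate-free lists of edges; |T| = length T.
IsEdgeDeterminingSet : ∀ {n m} → List (Edge n m) → Set
IsEdgeDeterminingSet {n} {m} T =
  (φ : Aut n m) → (∀ e → e ∈ T → FixesEdge φ e) → IsIdentity φ

Det′ : ℕ → ℕ → ℕ → Set
Det′ n m k =
  Σ (List (Edge n m)) (λ T → Unique T × IsEdgeDeterminingSet T × length T ≡ k)
  × ((T : List (Edge n m)) → Unique T → IsEdgeDeterminingSet T → k ≤ length T)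

-- Automorphisms of K_{n,m} either preserve or swap the two sides.
-- Lower bounds: two left (or right) vertices met by no edge of T can be
-- transposed while every edge of T stays fixed, so T meets all left vertices
-- but one and |T| ≥ n − 1.  If n = m and |T| ≤ n − 1, then T together with
-- the edge joining the two missed vertices meets every vertex with at most n
-- edges, so it is a perfect matching, and swapping the sides along it fixes
-- every edge of T.
-- Upper bound: the edges {t, t mod (m − 1)} for t < k, with k = n − 1 if
-- n > m and k = n if n = m, meet every vertex except at most one per side;
-- the two edges at the right vertex 0 rule out a side swap, and an
-- automorphism fixing all vertices but one on each side is the identity.

module Submission where

open import Defs
open import Data.Fin using (Fin; zero; toℕ; fromℕ; fromℕ<; inject₁; inject≤; punchIn; punchOut; _≟_)
open import Data.Fin.Permutation
  using (Permutation; Permutation′; transpose; flip; _∘ₚ_; _⟨$⟩ʳ_; _⟨$⟩ˡ_; inverseˡ; inverseʳ)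
  renaming (id to idₚ)
open import Data.Fin.Properties
  using (toℕ-injective; toℕ-fromℕ; toℕ-fromℕ<; fromℕ<-toℕ; fromℕ<-cong; fromℕ<-injective;
         toℕ-inject₁; toℕ-inject≤; inject≤-injective; toℕ<n; toℕ≤pred[n]; injective⇒≤;
         punchIn-punchOut; ¬∀⟶∃¬)
open import Data.List using (List; _∷_; map; length; lookup; allFin)
open import Data.List.Properties using (length-map; length-tabulate)
open import Data.List.Relation.Unary.Any using (here; there; index; any?)
open import Data.List.Relation.Unary.Any.Properties using (lookup-index; map⁻)
open import Data.List.Membership.Propositional using (_∈_; _∉_)
open import Data.List.Membership.Propositional.Properties using (∈-map⁺; ∈-map⁻; ∈-allFin)
open import Data.List.Relation.Unary.Unique.Propositional using (Unique)
import Data.List.Relation.Unary.Unique.Propositional.Properties as Unique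
open import Data.Nat using (ℕ; zero; suc; _≤_; _<_; _∸_; _≤?_; NonZero; ≢-nonZero⁻¹; >-nonZero⁻¹; s≤s)
open import Data.Nat.DivMod using (_mod_; n%n≡0; m<n⇒m%n≡m)
open import Data.Nat.Properties
  using (≤-refl; ≤-pred; n≤1+n; n<1+n; m<n⇒m<1+n; ≤∧≢⇒<; ≰⇒>; <⇒≱; <-≤-trans; <-trans)
open import Data.Product using (_×_; _,_; ∃; proj₁; proj₂)
open import Data.Sum using (_⊎_; inj₁; inj₂; [_,_])
import Data.Sum as Sum
open import Data.Sum.Properties using (inj₁-injective; inj₂-injective)
open import Data.Empty using (⊥)
open import Data.Unit using (tt)
open import Function using (_∘_; id)
open import Function.Bundles using (Inverse; Injection; Equivalence; _⇔_; mk↔ₛ′; mk⤖; mk⇔)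
open import Function.Consequences.Propositional using (strictlySurjective⇒surjective)
open import Function.Definitions using (Injective; StrictlySurjective)
open import Function.Properties.Bijection using (⤖⇒↔)
open import Function.Properties.Inverse using (↔⇒↣)
open import Relation.Nullary using (¬_; yes; no; contradiction)
open import Relation.Nullary.Decidable using (dec-true; dec-false)
open import Relation.Binary.PropositionalEquality
  using (_≡_; _≢_; refl; sym; trans; cong; cong₂; subst; subst₂; module ≡-Reasoning)

surjective⇒≥ : ∀ {k n} (f : Fin k → Fin n) → StrictlySurjective _≡_ f → n ≤ k
surjective⇒≥ f surj = injective⇒≤ {f = proj₁ ∘ surj} λ {x} {y} eq →
  trans (sym (proj₂ (surj x))) (trans (cong f eq) (proj₂ (surj y)))

surjective⇒injective : ∀ {k n} → k ≤ n → (f : Fin k → Fin n) →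
                       StrictlySurjective _≡_ f → Injective _≡_ _≡_ f
surjective⇒injective {suc k} k≤n f surj {p} {q} fp≡fq with p ≟ q
... | yes p≡q = p≡q
... | no p≢q = contradiction (surjective⇒≥ (f ∘ punchIn q) surj′) (<⇒≱ k≤n)
  where
  avoiding-q : ∀ x → ∃ λ x′ → f (punchIn q x′) ≡ f x
  avoiding-q x with q ≟ x
  ... | yes refl = punchOut (p≢q ∘ sym) , trans (cong f (punchIn-punchOut (p≢q ∘ sym))) fp≡fq
  ... | no q≢x = punchOut q≢x , cong f (punchIn-punchOut q≢x)
  -- Dropping position q keeps f onto, since q's value is also taken at p.
  surj′ : StrictlySurjective _≡_ (f ∘ punchIn q)
  surj′ y = let x , fx≡y = surj y ; x′ , fx′≡fx = avoiding-q x in x′ , trans fx′≡fx fx≡y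

surjection⇒permutation : ∀ {k n} → k ≤ n → (f : Fin k → Fin n) →
                         StrictlySurjective _≡_ f → Permutation k n
surjection⇒permutation k≤n f surj =
  ⤖⇒↔ (mk⤖ (surjective⇒injective k≤n f surj , strictlySurjective⇒surjective surj))

unused : ∀ {n} (xs : List (Fin n)) → length xs < n → ∃ λ a → a ∉ xs
unused {n} xs |xs|<n = ¬∀⟶∃¬ n (_∈ xs) (λ i → any? (i ≟_) xs) λ all∈ →
  <⇒≱ |xs|<n (surjective⇒≥ (lookup xs) λ i → index (all∈ i) , sym (lookup-index (all∈ i)))

unused-image : ∀ {A : Set} {n} (f : A → Fin n) (xs : List A) → length xs < n →
               ∃ λ a → a ∉ map f xs
unused-image {n = n} f xs |xs|<n = unused (map f xs) (subst (_< n) (sym (length-map f xs)) |xs|<n)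

positions-onto : ∀ {A : Set} {n} (f : A → Fin n) (xs : List A) →
                 (∀ y → y ∈ map f xs) → StrictlySurjective _≡_ (f ∘ lookup xs)
positions-onto f xs cover y = index (map⁻ (cover y)) , sym (lookup-index (map⁻ (cover y)))

≢fromℕ⇒< : ∀ {n} (i : Fin (suc n)) → i ≢ fromℕ n → toℕ i < n
≢fromℕ⇒< {n} i i≢last =
  ≤∧≢⇒< (toℕ≤pred[n] i) λ eq → i≢last (toℕ-injective (trans eq (sym (toℕ-fromℕ n))))

transpose-fixes : ∀ {n} {a b x : Fin n} → x ≢ a → x ≢ b → transpose a b ⟨$⟩ʳ x ≡ x
transpose-fixes {a = a} {b} {x} x≢a x≢b rewrite dec-false (x ≟ a) x≢a | dec-false (x ≟ b) x≢b = refl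

transpose-moves : ∀ {n} {a b : Fin n} → transpose a b ⟨$⟩ʳ a ≡ b
transpose-moves {a = a} rewrite dec-true (a ≟ a) refl = refl

infixr 9 _·_
_·_ : ∀ {n m} → Aut n m → V n m → V n m
φ · v = Inverse.to (perm φ) v

·-injective : ∀ {n m} (φ : Aut n m) → Injective _≡_ _≡_ (φ ·_)
·-injective φ = Injection.injective (↔⇒↣ (perm φ))

left-images-same-side : ∀ {n m} (φ : Aut n m) {i i′ x y} →
                        φ · inj₁ i ≡ inj₁ x → φ · inj₁ i′ ≡ inj₂ y → ⊥
left-images-same-side φ {i} {i′} p q =
  Equivalence.from (preserve φ (inj₁ i) (inj₁ i′)) (subst₂ Adj (sym p) (sym q) tt)

image-fixed⇒fixed : ∀ {n m} (φ : Aut n m) {v w} → φ · v ≡ w → φ · w ≡ w ⊎ w ≡ v → φ · v ≡ v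
image-fixed⇒fixed φ φv≡w (inj₁ φw≡w) = trans φv≡w (·-injective φ (trans φw≡w (sym φv≡w)))
image-fixed⇒fixed φ φv≡w (inj₂ w≡v)  = trans φv≡w w≡v

sideAut : ∀ {n m} → Permutation′ n → Permutation′ m → Aut n m
sideAut {n} {m} π σ = record { perm = mk↔ₛ′ to from to-from from-to ; preserve = preserves }
  where
  to from : V n m → V n m
  to   = Sum.map (π ⟨$⟩ʳ_) (σ ⟨$⟩ʳ_)
  from = Sum.map (π ⟨$⟩ˡ_) (σ ⟨$⟩ˡ_)
  to-from : ∀ v → to (from v) ≡ v
  to-from (inj₁ i) = cong inj₁ (inverseʳ π)
  to-from (inj₂ j) = cong inj₂ (inverseʳ σ)
  from-to : ∀ v → from (to v) ≡ v
  from-to (inj₁ i) = cong inj₁ (inverseˡ π)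
  from-to (inj₂ j) = cong inj₂ (inverseˡ σ)
  preserves : ∀ u v → Adj u v ⇔ Adj (to u) (to v)
  preserves (inj₁ _) (inj₁ _) = mk⇔ id id
  preserves (inj₁ _) (inj₂ _) = mk⇔ id id
  preserves (inj₂ _) (inj₁ _) = mk⇔ id id
  preserves (inj₂ _) (inj₂ _) = mk⇔ id id

crossAut : ∀ {n m} → Permutation n m → Aut n m
crossAut {n} {m} π = record { perm = mk↔ₛ′ cross cross involutive involutive ; preserve = preserves }
  where
  cross : V n m → V n m
  cross (inj₁ i) = inj₂ (π ⟨$⟩ʳ i)
  cross (inj₂ j) = inj₁ (π ⟨$⟩ˡ j)
  involutive : ∀ v → cross (cross v) ≡ v
  involutive (inj₁ i) = cong inj₁ (inverseˡ π)
  involutive (inj₂ j) = cong inj₂ (inverseʳ π)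
  preserves : ∀ u v → Adj u v ⇔ Adj (cross u) (cross v)
  preserves (inj₁ _) (inj₁ _) = mk⇔ id id
  preserves (inj₁ _) (inj₂ _) = mk⇔ id id
  preserves (inj₂ _) (inj₁ _) = mk⇔ id id
  preserves (inj₂ _) (inj₂ _) = mk⇔ id id

lefts : ∀ {n m} → List (Edge n m) → List (Fin n)
lefts = map proj₁

rights : ∀ {n m} → List (Edge n m) → List (Fin m)
rights = map proj₂

sideAut-fixes : ∀ {n m} {T : List (Edge n m)} (π : Permutation′ n) (σ : Permutation′ m) →
                (∀ {i} → i ∈ lefts T → π ⟨$⟩ʳ i ≡ i) → (∀ {j} → j ∈ rights T → σ ⟨$⟩ʳ j ≡ j) →
                ∀ e → e ∈ T → FixesEdge (sideAut π σ) e
sideAut-fixes π σ π-fixes σ-fixes e e∈T =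
  inj₁ (cong inj₁ (π-fixes (∈-map⁺ proj₁ e∈T)) , cong inj₂ (σ-fixes (∈-map⁺ proj₂ e∈T)))

transpose-fixes-others : ∀ {n} {a b x : Fin n} {xs : List (Fin n)} →
                         a ∉ xs → b ∉ xs → x ∈ xs → transpose a b ⟨$⟩ʳ x ≡ x
transpose-fixes-others a∉ b∉ x∈ =
  transpose-fixes (λ { refl → a∉ x∈ }) (λ { refl → b∉ x∈ })

two-unused-lefts⇒¬determining : ∀ {n m} {T : List (Edge n m)} {a b} → a ≢ b →
                                a ∉ lefts T → b ∉ lefts T → ¬ IsEdgeDeterminingSet T
two-unused-lefts⇒¬determining {n} {m} {T} {a} {b} a≢b a∉ b∉ determining =
  a≢b (inj₁-injective (trans (sym (determining φ fixes (inj₁ a))) a↦b))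
  where
  φ : Aut n m
  φ = sideAut (transpose a b) idₚ
  fixes : ∀ e → e ∈ T → FixesEdge φ e
  fixes = sideAut-fixes (transpose a b) idₚ (transpose-fixes-others a∉ b∉) (λ _ → refl)
  a↦b : φ · inj₁ a ≡ inj₁ b
  a↦b = cong inj₁ (transpose-moves {a = a})

two-unused-rights⇒¬determining : ∀ {n m} {T : List (Edge n m)} {a b} → a ≢ b →
                                 a ∉ rights T → b ∉ rights T → ¬ IsEdgeDeterminingSet T
two-unused-rights⇒¬determining {n} {m} {T} {a} {b} a≢b a∉ b∉ determining =
  a≢b (inj₂-injective (trans (sym (determining φ fixes (inj₂ a))) a↦b))
  where
  φ : Aut n m
  φ = sideAut idₚ (transpose a b)
  fixes : ∀ e → e ∈ T → FixesEdge φ e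
  fixes = sideAut-fixes idₚ (transpose a b) (λ _ → refl) (transpose-fixes-others a∉ b∉)
  a↦b : φ · inj₂ a ≡ inj₂ b
  a↦b = cong inj₂ (transpose-moves {a = a})

determining⇒lefts-cover : ∀ {n m} {T : List (Edge n m)} {a} → IsEdgeDeterminingSet T →
                          a ∉ lefts T → ∀ i → i ∈ a ∷ lefts T
determining⇒lefts-cover {T = T} {a} determining a∉ i with i ≟ a | any? (i ≟_) (lefts T)
... | yes i≡a | _      = here i≡a
... | no _    | yes i∈ = there i∈
... | no i≢a  | no i∉  = contradiction determining (two-unused-lefts⇒¬determining i≢a i∉ a∉)

determining⇒rights-cover : ∀ {n m} {T : List (Edge n m)} {b} → IsEdgeDeterminingSet T →
                           b ∉ rights T → ∀ j → j ∈ b ∷ rights T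
determining⇒rights-cover {T = T} {b} determining b∉ j with j ≟ b | any? (j ≟_) (rights T)
... | yes j≡b | _      = here j≡b
... | no _    | yes j∈ = there j∈
... | no j≢b  | no j∉  = contradiction determining (two-unused-rights⇒¬determining j≢b j∉ b∉)

lower-bound : ∀ {n m} (T : List (Edge (suc n) m)) → IsEdgeDeterminingSet T → n ≤ length T
lower-bound {n} T determining with n ≤? length T
... | yes n≤|T| = n≤|T|
... | no n≰|T| =
  let |T|<n = ≰⇒> n≰|T|
      a , a∉ = unused-image proj₁ T (m<n⇒m<1+n |T|<n)
      b , b∉ = unused (a ∷ lefts T) (s≤s (subst (_< n) (sym (length-map proj₁ T)) |T|<n))
  in contradiction determining (two-unused-lefts⇒¬determining (b∉ ∘ here) (b∉ ∘ there) a∉)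

perfect-matching : ∀ {n m} (T : List (Edge n m)) → length T ≤ n → length T ≤ m →
                   (∀ i → i ∈ lefts T) → (∀ j → j ∈ rights T) →
                   ∃ λ (π : Permutation n m) → ∀ {i j} → (i , j) ∈ T → π ⟨$⟩ʳ i ≡ j
perfect-matching {n} {m} T |T|≤n |T|≤m lefts-onto rights-onto = flip P ∘ₚ Q , matches
  where
  P : Permutation (length T) n
  P = surjection⇒permutation |T|≤n (proj₁ ∘ lookup T) (positions-onto proj₁ T lefts-onto)
  Q : Permutation (length T) m
  Q = surjection⇒permutation |T|≤m (proj₂ ∘ lookup T) (positions-onto proj₂ T rights-onto)
  matches : ∀ {i j} → (i , j) ∈ T → Q ⟨$⟩ʳ (P ⟨$⟩ˡ i) ≡ j
  matches {i} {j} e∈T = begin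
    Q ⟨$⟩ʳ (P ⟨$⟩ˡ i)          ≡⟨ cong (λ e → Q ⟨$⟩ʳ (P ⟨$⟩ˡ proj₁ e)) (lookup-index e∈T) ⟩
    Q ⟨$⟩ʳ (P ⟨$⟩ˡ (P ⟨$⟩ʳ r)) ≡⟨ cong (Q ⟨$⟩ʳ_) (inverseˡ P) ⟩
    Q ⟨$⟩ʳ r                   ≡⟨ cong proj₂ (lookup-index e∈T) ⟨
    j                          ∎
    where
    open ≡-Reasoning
    r : Fin (length T)
    r = index e∈T

crossAut-fixes : ∀ {n m} {T : List (Edge n m)} (π : Permutation n m) →
                 (∀ {i j} → (i , j) ∈ T → π ⟨$⟩ʳ i ≡ j) → ∀ e → e ∈ T → FixesEdge (crossAut π) e
crossAut-fixes π matches (i , j) e∈T =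
  inj₂ (cong inj₂ (matches e∈T) , cong inj₁ (trans (cong (π ⟨$⟩ˡ_) (sym (matches e∈T))) (inverseˡ π)))

square-lower-bound : ∀ {n} (T : List (Edge n n)) → IsEdgeDeterminingSet T → n ≤ length T
square-lower-bound {n} T determining with n ≤? length T
... | yes n≤|T| = n≤|T|
... | no n≰|T| =
  let |T|<n = ≰⇒> n≰|T|
      a , a∉ = unused-image proj₁ T |T|<n
      b , b∉ = unused-image proj₂ T |T|<n
      π , matches = perfect-matching ((a , b) ∷ T) |T|<n |T|<n
                      (determining⇒lefts-cover determining a∉) (determining⇒rights-cover determining b∉)
  in contradiction (determining (crossAut π) (λ e → crossAut-fixes π matches e ∘ there) (inj₁ a)) λ ()

fixes-ends : ∀ {n m} (φ : Aut n m) {c c′ i j} → φ · inj₁ c ≡ inj₁ c′ → FixesEdge φ (i , j) →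
             φ · inj₁ i ≡ inj₁ i × φ · inj₂ j ≡ inj₂ j
fixes-ends φ c↦left (inj₁ fixed)        = fixed
fixes-ends φ c↦left (inj₂ (flipped , _)) = contradiction flipped (left-images-same-side φ c↦left)

shared-right-end⇒fixed : ∀ {n m} (φ : Aut n m) {i i′ j} → FixesEdge φ (i , j) → FixesEdge φ (i′ , j) →
                         i ≢ i′ → φ · inj₁ i ≡ inj₁ i
shared-right-end⇒fixed φ (inj₁ (fixed , _)) _                _    = fixed
shared-right-end⇒fixed φ (inj₂ (_ , j↦i))  (inj₁ (_ , j↦j))  _    =
  contradiction (trans (sym j↦i) j↦j) λ ()
shared-right-end⇒fixed φ (inj₂ (_ , j↦i))  (inj₂ (_ , j↦i′)) i≢i′ =
  contradiction (inj₁-injective (trans (sym j↦i) j↦i′)) i≢i′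

identity-if-all-but-one-fixed : ∀ {n m} (φ : Aut n m) {a : Fin n} {b : Fin m} {c} →
                                φ · inj₁ c ≡ inj₁ c →
                                (∀ i → i ≢ a → φ · inj₁ i ≡ inj₁ i) →
                                (∀ j → j ≢ b → φ · inj₂ j ≡ inj₂ j) →
                                IsIdentity φ
identity-if-all-but-one-fixed φ {a} {b} c-fixed fixes-left fixes-right = λ where
    (inj₁ i) → all-left-fixed i
    (inj₂ j) → all-right-fixed j
  where
  fixed-or-a : ∀ i → φ · inj₁ i ≡ inj₁ i ⊎ i ≡ a
  fixed-or-a i with i ≟ a
  ... | yes i≡a = inj₂ i≡a
  ... | no i≢a  = inj₁ (fixes-left i i≢a)
  fixed-or-b : ∀ j → φ · inj₂ j ≡ inj₂ j ⊎ j ≡ b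
  fixed-or-b j with j ≟ b
  ... | yes j≡b = inj₂ j≡b
  ... | no j≢b  = inj₁ (fixes-right j j≢b)
  a-fixed : ∀ w → φ · inj₁ a ≡ w → φ · inj₁ a ≡ inj₁ a
  a-fixed (inj₁ x) a↦x = image-fixed⇒fixed φ a↦x (Sum.map₂ (cong inj₁) (fixed-or-a x))
  a-fixed (inj₂ y) a↦y = contradiction a↦y (left-images-same-side φ c-fixed)
  all-left-fixed : ∀ i → φ · inj₁ i ≡ inj₁ i
  all-left-fixed i = [ id , (λ { refl → a-fixed (φ · inj₁ a) refl }) ] (fixed-or-a i)
  b-fixed : ∀ w → φ · inj₂ b ≡ w → φ · inj₂ b ≡ inj₂ b
  b-fixed (inj₁ x) b↦x = image-fixed⇒fixed φ b↦x (inj₁ (all-left-fixed x))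
  b-fixed (inj₂ y) b↦y = image-fixed⇒fixed φ b↦y (Sum.map₂ (cong inj₂) (fixed-or-b y))
  all-right-fixed : ∀ j → φ · inj₂ j ≡ inj₂ j
  all-right-fixed j = [ id , (λ { refl → b-fixed (φ · inj₂ b) refl }) ] (fixed-or-b j)

determining-if-covering : ∀ {n m} (T : List (Edge n m)) {a : Fin n} {b : Fin m} →
                          (∀ i → i ≢ a → i ∈ lefts T) → (∀ j → j ≢ b → j ∈ rights T) →
                          ∀ {i i′ j} → (i , j) ∈ T → (i′ , j) ∈ T → i ≢ i′ → IsEdgeDeterminingSet T
determining-if-covering T {a} {b} covers-left covers-right {i} e∈T e′∈T i≢i′ φ fixes =
  identity-if-all-but-one-fixed φ i-fixed fixes-left fixes-right
  where
  i-fixed : φ · inj₁ i ≡ inj₁ i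
  i-fixed = shared-right-end⇒fixed φ (fixes _ e∈T) (fixes _ e′∈T) i≢i′
  ends-fixed : ∀ {i j} → (i , j) ∈ T → φ · inj₁ i ≡ inj₁ i × φ · inj₂ j ≡ inj₂ j
  ends-fixed e∈T = fixes-ends φ i-fixed (fixes _ e∈T)
  fixes-left : ∀ i → i ≢ a → φ · inj₁ i ≡ inj₁ i
  fixes-left i i≢a with ∈-map⁻ proj₁ (covers-left i i≢a)
  ... | _ , e∈T , refl = proj₁ (ends-fixed e∈T)
  fixes-right : ∀ j → j ≢ b → φ · inj₂ j ≡ inj₂ j
  fixes-right j j≢b with ∈-map⁻ proj₂ (covers-right j j≢b)
  ... | _ , e∈T , refl = proj₂ (ends-fixed e∈T)

module _ (m′ : ℕ) .{{_ : NonZero m′}} where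

  wrap : ℕ → Fin (suc m′)
  wrap t = inject₁ (t mod m′)

  wrap-small : (j : Fin (suc m′)) → toℕ j < m′ → wrap (toℕ j) ≡ j
  wrap-small j j<m′ = toℕ-injective (trans (toℕ-inject₁ _) (trans (toℕ-fromℕ< _) (m<n⇒m%n≡m j<m′)))

  wrap-period : wrap m′ ≡ wrap 0
  wrap-period =
    cong inject₁ (fromℕ<-cong _ _ (trans (n%n≡0 m′) (sym (m<n⇒m%n≡m (>-nonZero⁻¹ m′)))) _ _)

  modEdges : ∀ {n} (k : ℕ) → k ≤ n → List (Edge n (suc m′))
  modEdges k k≤n = map (λ t → inject≤ t k≤n , wrap (toℕ t)) (allFin k)

  module _ {n k : ℕ} (k≤n : k ≤ n) where

    modEdges-unique : Unique (modEdges k k≤n)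
    modEdges-unique = Unique.map⁺ (inject≤-injective _ _ _ _ ∘ cong proj₁) (Unique.allFin⁺ k)

    length-modEdges : length (modEdges k k≤n) ≡ k
    length-modEdges = trans (length-map _ (allFin k)) (length-tabulate id)

    ∈-modEdges : ∀ {t} (t<k : t < k) → (fromℕ< (<-≤-trans t<k k≤n) , wrap t) ∈ modEdges k k≤n
    ∈-modEdges {t} t<k = subst (_∈ modEdges k k≤n) (cong₂ _,_ same-left (cong wrap (toℕ-fromℕ< t<k)))
                           (∈-map⁺ _ (∈-allFin (fromℕ< t<k)))
      where
      same-left : inject≤ (fromℕ< t<k) k≤n ≡ fromℕ< (<-≤-trans t<k k≤n)
      same-left =
        toℕ-injective (trans (toℕ-inject≤ _ k≤n) (trans (toℕ-fromℕ< t<k) (sym (toℕ-fromℕ< _))))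

    modEdges-determining : m′ < k → ∀ {a} → (∀ i → i ≢ a → toℕ i < k) →
                           IsEdgeDeterminingSet (modEdges k k≤n)
    modEdges-determining m′<k {a} small =
      determining-if-covering (modEdges k k≤n) covers-left covers-right
        (∈-modEdges (<-trans (>-nonZero⁻¹ m′) m′<k))
        (subst (λ r → (fromℕ< (<-≤-trans m′<k k≤n) , r) ∈ modEdges k k≤n) wrap-period
               (∈-modEdges m′<k))
        (λ eq → ≢-nonZero⁻¹ m′ (sym (fromℕ<-injective 0 m′ _ _ eq)))
      where
      covers-left : ∀ i → i ≢ a → i ∈ lefts (modEdges k k≤n)
      covers-left i i≢a = subst (_∈ lefts (modEdges k k≤n)) (fromℕ<-toℕ i _)
                            (∈-map⁺ proj₁ (∈-modEdges (small i i≢a)))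
      covers-right : ∀ j → j ≢ fromℕ m′ → j ∈ rights (modEdges k k≤n)
      covers-right j j≢last = subst (_∈ rights (modEdges k k≤n)) (wrap-small j j<m′)
                                (∈-map⁺ proj₂ (∈-modEdges (<-trans j<m′ m′<k)))
        where
        j<m′ : toℕ j < m′
        j<m′ = ≢fromℕ⇒< j j≢last

theorem7 : (n m : ℕ) → 1 < m → m ≤ n →
    (n ≢ m → Det′ n m (n ∸ 1)) × (n ≡ m → Det′ n m n)
theorem7 _        (suc zero)       (s≤s ()) _
theorem7 (suc n′) (suc (suc m″)) _ m≤n = non-square , square
  where
  m′ : ℕ
  m′ = suc m″
  non-square : suc n′ ≢ suc m′ → Det′ (suc n′) (suc m′) n′
  non-square n≢m =
    ( modEdges m′ n′ (n≤1+n n′)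
    , modEdges-unique m′ (n≤1+n n′)
    , modEdges-determining m′ (n≤1+n n′) m′<n′ ≢fromℕ⇒<
    , length-modEdges m′ (n≤1+n n′) )
    , λ T _ → lower-bound T
    where
    m′<n′ : m′ < n′
    m′<n′ = ≤∧≢⇒< (≤-pred m≤n) (n≢m ∘ cong suc ∘ sym)
  square : suc n′ ≡ suc m′ → Det′ (suc n′) (suc m′) (suc n′)
  square refl =
    ( modEdges m′ (suc m′) ≤-refl
    , modEdges-unique m′ ≤-refl
    , modEdges-determining m′ ≤-refl (n<1+n m′) {a = zero} (λ i _ → toℕ<n i)
    , length-modEdges m′ ≤-refl )
    , λ T _ → square-lower-bound T
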